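{- For all integers $k\ge0$ and all $a,u\in\mathbb{C}$, $$\mathbf{D}_{s,t}^{k}\,\mathrm{exp}_{s,t}(az,u)=a^{k}u^{\binom{k}{2}}\,\mathrm{exp}_{s,t}(au^{k}z,u),$$ where $\mathbf{D}_{s,t}$ acts on the variable $z$.
   Context: Let $s,t$ be nonzero complex numbers with $s^2+4t\neq0$, and $\varphi=\frac{s+\sqrt{s^2+4t}}{2}$, $\phi=\frac{s-\sqrt{s^2+4t}}{2}$. The Lucas sequence is $\{0\}_{s,t}=0$, $\{1\}_{s,t}=1$, $\{n+2\}_{s,t}=s\{n+1\}_{s,t}+t\{n\}_{s,t}$; it is assumed $\{n\}_{s,t}\neq0$ for $n\ge1$, and $\{n\}_{s,t}!=\{1\}_{s,t}\cdots\{n\}_{s,t}$, $\{0\}_{s,t}!=1$. The Lucas derivative is $(\mathbf{D}_{s,t}f)(z)=\frac{f(\varphi z)-f(\phi z)}{(\varphi-\phi)z}$ for $z\ne0$, $(\mathbf{D}_{s,t}f)(0)=f'(0)$; $\mathbf{D}^k_{s,t}$ is its $k$-fold iterate. The Lucas-Pantograph exponential is $\mathrm{exp}_{s,t}(z,u)=\sum_{n\ge0}u^{\binom{n}{2}}\frac{z^n}{\{n\}_{s,t}!}$ for $u\neq0$ and $\mathrm{exp}_{s,t}(z,0)=1+z$ (this agrees with the series under the convention $0^0=1$). Series are considered where they converge (or as formal power series, with $\mathbf D_{s,t}z^n=\{n\}_{s,t}z^{n-1}$). -}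

module Defs where

open import Level using (Level)
open import Data.Nat using (ℕ; zero; suc)
open import Data.Nat.Combinatorics using (_C_)
open import Algebra.Bundles using (CommutativeRing)

-- Everything is parametrised by a commutative ring R (standing in for ℂ)
-- and the Lucas parameters s t.
module Lucas {c ℓ : Level} (R : CommutativeRing c ℓ) (s t : CommutativeRing.Carrier R) where
  open CommutativeRing R

  _^_ : Carrier → ℕ → Carrier
  x ^ zero  = 1#
  x ^ suc n = x * (x ^ n)

  lucas : ℕ → Carrier
  lucas zero            = 0#
  lucas (suc zero)      = 1#
  lucas (suc (suc n))   = s * lucas (suc n) + t * lucas n

  -- Formal power series in z: coefficient sequences
  FPS : Set c
  FPS = ℕ → Carrier

  -- Lucas derivative on formal power series: D z^n = {n} z^(n-1)
  D : FPS → FPS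
  D f n = lucas (suc n) * f (suc n)

  Dⁿ : ℕ → FPS → FPS
  Dⁿ zero    f = f
  Dⁿ (suc k) f = D (Dⁿ k f)

  -- Given inverses inv n of {n+1}, the inverse of the Lucas factorial {n}!
  invFact : (ℕ → Carrier) → ℕ → Carrier
  invFact inv zero    = 1#
  invFact inv (suc n) = invFact inv n * inv n

  -- coefficients of exp_{s,t}(a z, u) = Σ u^(n choose 2) (a z)^n / {n}!
  expLP : (ℕ → Carrier) → Carrier → Carrier → FPS
  expLP inv a u n = (u ^ (n C 2)) * ((a ^ n) * invFact inv n)

-- On coefficients, D shifts the index down by one and multiplies by {n+1}, which cancels
-- the new factor 1/{n+1} of the Lucas factorial. Since C(n+1,2) = n + C(n,2), the shifted
-- pantograph weight u^C(n+1,2) leaves behind an extra u^n, so D exp(az,u) = a exp(auz,u).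
-- Iterating k times multiplies a by u^k and collects a^k u^(0+1+...+(k-1)) = a^k u^C(k,2).
module Submission where

open import Defs
open import Level using (Level)
open import Data.Nat using (ℕ; zero; suc) renaming (_+_ to _+ℕ_)
open import Data.Nat.Combinatorics using (_C_; nC1≡n; nCk+nC[k+1]≡[n+1]C[k+1])
open import Relation.Nullary using (¬_)
open import Algebra.Bundles using (CommutativeRing)
open import Relation.Binary.PropositionalEquality as ≡ using (_≡_)
import Algebra.Properties.CommutativeSemiring.Exp as SemiringExp
import Algebra.Properties.CommutativeSemigroup as CommutativeSemigroupProperties
import Algebra.Solver.CommutativeMonoid as CommutativeMonoidSolver
import Relation.Binary.Reasoning.Setoid as SetoidReasoning

[1+n]C2≡n+nC2 : ∀ n → suc n C 2 ≡ n +ℕ n C 2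
[1+n]C2≡n+nC2 n = ≡.trans (≡.sym (nCk+nC[k+1]≡[n+1]C[k+1] n 1)) (≡.cong (_+ℕ n C 2) (nC1≡n n))

module LucasPantograph {c ℓ : Level} (R : CommutativeRing c ℓ) (s t : CommutativeRing.Carrier R) where
  open CommutativeRing R
  open Lucas R s t
  open SetoidReasoning setoid
  open SemiringExp commutativeSemiring using () renaming (_^_ to _^ˢ_)
  open CommutativeSemigroupProperties *-commutativeSemigroup using (x∙yz≈y∙xz; xy∙z≈x∙zy)
  open CommutativeMonoidSolver *-commutativeMonoid using (solve; _⊜_; _⊕_)

  ^≡^ˢ : ∀ x n → x ^ n ≡ x ^ˢ n
  ^≡^ˢ x zero    = ≡.refl
  ^≡^ˢ x (suc n) = ≡.cong (x *_) (^≡^ˢ x n)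

  ^-congˡ : ∀ {x y} n → x ≈ y → x ^ n ≈ y ^ n
  ^-congˡ {x} {y} n x≈y rewrite ^≡^ˢ x n | ^≡^ˢ y n = SemiringExp.^-congˡ commutativeSemiring n x≈y

  ^-homo-* : ∀ x m n → x ^ (m +ℕ n) ≈ x ^ m * x ^ n
  ^-homo-* x m n rewrite ^≡^ˢ x (m +ℕ n) | ^≡^ˢ x m | ^≡^ˢ x n = SemiringExp.^-homo-* commutativeSemiring x m n

  ^-distrib-* : ∀ x y n → (x * y) ^ n ≈ x ^ n * y ^ n
  ^-distrib-* x y n rewrite ^≡^ˢ (x * y) n | ^≡^ˢ x n | ^≡^ˢ y n = SemiringExp.^-distrib-* commutativeSemiring x y n

  ^[1+n]C2 : ∀ u n → u ^ (suc n C 2) ≈ u ^ n * u ^ (n C 2)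
  ^[1+n]C2 u n rewrite [1+n]C2≡n+nC2 n = ^-homo-* u n (n C 2)

  D-cong : ∀ {f g : FPS} → (∀ n → f n ≈ g n) → ∀ n → D f n ≈ D g n
  D-cong f≈g n = *-congˡ (f≈g (suc n))

  D-*ˡ : ∀ x (f : FPS) n → D (λ m → x * f m) n ≈ x * D f n
  D-*ˡ x f n = x∙yz≈y∙xz (lucas (suc n)) x (f (suc n))

  module _ (inv : ℕ → Carrier) (inv-lucas : ∀ n → lucas (suc n) * inv n ≈ 1#) where

    expLP-congˡ : ∀ {a b} u n → a ≈ b → expLP inv a u n ≈ expLP inv b u n
    expLP-congˡ u n a≈b = *-congˡ (*-congʳ (^-congˡ n a≈b))

    D-expLP : ∀ a u n → D (expLP inv a u) n ≈ a * expLP inv (a * u) u n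
    D-expLP a u n = begin
      lucas (suc n) * (u ^ (suc n C 2) * ((a * a ^ n) * (invFact inv n * inv n)))
        ≈⟨ *-congˡ (*-congʳ (^[1+n]C2 u n)) ⟩
      lucas (suc n) * ((u ^ n * u ^ (n C 2)) * ((a * a ^ n) * (invFact inv n * inv n)))
        ≈⟨ solve 7 (λ L Un U2 A An F I →
                      L ⊕ ((Un ⊕ U2) ⊕ ((A ⊕ An) ⊕ (F ⊕ I))) ⊜ (L ⊕ I) ⊕ (A ⊕ (U2 ⊕ ((An ⊕ Un) ⊕ F))))
                    refl (lucas (suc n)) (u ^ n) (u ^ (n C 2)) a (a ^ n) (invFact inv n) (inv n) ⟩
      (lucas (suc n) * inv n) * (a * (u ^ (n C 2) * ((a ^ n * u ^ n) * invFact inv n)))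
        ≈⟨ trans (*-congʳ (inv-lucas n)) (*-identityˡ _) ⟩
      a * (u ^ (n C 2) * ((a ^ n * u ^ n) * invFact inv n))
        ≈⟨ *-congˡ (*-congˡ (*-congʳ (sym (^-distrib-* a u n)))) ⟩
      a * expLP inv (a * u) u n ∎

    prefactor-suc : ∀ a u k → (a ^ k * u ^ (k C 2)) * (a * u ^ k) ≈ a ^ suc k * u ^ (suc k C 2)
    prefactor-suc a u k = begin
      (a ^ k * u ^ (k C 2)) * (a * u ^ k)
        ≈⟨ solve 4 (λ Ak U2 A Uk → (Ak ⊕ U2) ⊕ (A ⊕ Uk) ⊜ (A ⊕ Ak) ⊕ (Uk ⊕ U2)) refl (a ^ k) (u ^ (k C 2)) a (u ^ k) ⟩
      (a * a ^ k) * (u ^ k * u ^ (k C 2))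
        ≈⟨ *-congˡ (sym (^[1+n]C2 u k)) ⟩
      a ^ suc k * u ^ (suc k C 2) ∎

    Dⁿ-expLP : ∀ k a u n → Dⁿ k (expLP inv a u) n ≈ (a ^ k * u ^ (k C 2)) * expLP inv (a * u ^ k) u n
    Dⁿ-expLP zero a u n =
      sym (trans (*-congʳ (*-identityˡ 1#)) (trans (*-identityˡ _) (expLP-congˡ u n (*-identityʳ a))))
    Dⁿ-expLP (suc k) a u n = begin
      D (Dⁿ k (expLP inv a u)) n            ≈⟨ D-cong (Dⁿ-expLP k a u) n ⟩
      D (λ m → κ * expLP inv b u m) n       ≈⟨ D-*ˡ κ (expLP inv b u) n ⟩
      κ * D (expLP inv b u) n               ≈⟨ *-congˡ (D-expLP b u n) ⟩
      κ * (b * expLP inv (b * u) u n)       ≈⟨ *-assoc κ b _ ⟨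
      (κ * b) * expLP inv (b * u) u n       ≈⟨ *-cong (prefactor-suc a u k) (expLP-congˡ u n (xy∙z≈x∙zy a (u ^ k) u)) ⟩
      (a ^ suc k * u ^ (suc k C 2)) * expLP inv (a * u ^ suc k) u n ∎
      where
      κ = a ^ k * u ^ (k C 2)
      b = a * u ^ k

mainTheorem3 : ∀ {c ℓ : Level} (R : CommutativeRing c ℓ) →
    let open CommutativeRing R in
    (s t : Carrier) →
    let open Lucas R s t in
    ¬ (s ≈ 0#) → ¬ (t ≈ 0#) → ¬ ((s * s) + ((1# + 1# + 1# + 1#) * t) ≈ 0#) →
    (inv : ℕ → Carrier) → (∀ n → lucas (suc n) * inv n ≈ 1#) →
    ∀ (k : ℕ) (a u : Carrier) (n : ℕ) →
    Dⁿ k (expLP inv a u) n ≈ ((a ^ k) * (u ^ (k C 2))) * expLP inv (a * (u ^ k)) u n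
mainTheorem3 R s t _ _ _ inv inv-lucas = LucasPantograph.Dⁿ-expLP R s t inv inv-lucas
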